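{- For every positive integer $n$, $r\bigl(F_4,K_n^{(4)}\bigr)>2^{n-2}$.
   Context: $F_4$ is the $13$-vertex linear $4$-uniform hypergraph whose vertices are the points of the projective plane $\mathrm{PG}(2,3)$ over $\mathbb{F}_3$ and whose edges are its lines (each line has $4$ points). $K_n^{(4)}$ denotes the complete $4$-uniform hypergraph on $n$ vertices. For $4$-uniform hypergraphs $H_1,H_2$, $r(H_1,H_2)$ is the least integer $N$ such that every red/blue colouring of the edges of $K_N^{(4)}$ contains a red copy of $H_1$ or a blue copy of $H_2$. -}

module Defs where

open import Data.Nat using (ℕ; zero; suc; _+_; _*_; _%_)
open import Data.Bool using (Bool; true; false; _∧_; _∨_)
open import Data.Fin using (Fin; toℕ; _≟_; #_)
import Data.Fin.Properties as FinP
import Data.Nat as ℕ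
open import Data.Sum using (_⊎_)
open import Data.Unit using (tt)
open import Data.Fin.Subset using (Subset; ∣_∣)
open import Data.Vec using (Vec; []; _∷_; _++_; lookup; tabulate; map; allFin)
open import Data.Product using (Σ; ∃; _×_; _,_)
open import Relation.Nullary.Decidable using (isYes; toWitness)
open import Relation.Binary.PropositionalEquality using (_≡_; refl)
open import Function.Definitions using (Injective)

anyFin : ∀ {n} → (Fin n → Bool) → Bool
anyFin {zero}  p = false
anyFin {suc n} p = p Fin.zero ∨ anyFin (λ i → p (Fin.suc i))

record Hypergraph4 : Set₁ where
  field
    v       : ℕ
    IsEdge  : Subset v → Set
    edge4   : ∀ e → IsEdge e → ∣ e ∣ ≡ 4

open Hypergraph4 public

data Colour : Set where
  red blue : Colour

-- A red/blue colouring of the edges of K_N^(4): a colour for every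
-- subset of Fin N (only the values on 4-element subsets are relevant).
Colouring : ℕ → Set
Colouring N = Subset N → Colour

image : ∀ {v N} → (Fin v → Fin N) → Subset v → Subset N
image {v} f e = tabulate (λ x → anyFin (λ i → lookup e i ∧ isYes (f i ≟ x)))

MonoCopy : ∀ {N} → Colouring N → Colour → Hypergraph4 → Set
MonoCopy {N} c col H =
  Σ (Fin (v H) → Fin N) λ f →
    Injective _≡_ _≡_ f × (∀ e → IsEdge H e → c (image f e) ≡ col)

K4 : ℕ → Hypergraph4
K4 n = record { v = n ; IsEdge = λ e → ∣ e ∣ ≡ 4 ; edge4 = λ e p → p }

-- F_4: points and lines of PG(2,3).  Points are the 13 normalised nonzero
-- vectors of F_3^3 (first nonzero coordinate equal to 1).
Vec3 : Set
Vec3 = Fin 3 × Fin 3 × Fin 3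

points : Vec Vec3 13
points =
    (# 1 , # 0 , # 0)
  ∷ (# 1 , # 0 , # 1)
  ∷ (# 1 , # 0 , # 2)
  ∷ (# 1 , # 1 , # 0)
  ∷ (# 1 , # 1 , # 1)
  ∷ (# 1 , # 1 , # 2)
  ∷ (# 1 , # 2 , # 0)
  ∷ (# 1 , # 2 , # 1)
  ∷ (# 1 , # 2 , # 2)
  ∷ (# 0 , # 1 , # 0)
  ∷ (# 0 , # 1 , # 1)
  ∷ (# 0 , # 1 , # 2)
  ∷ (# 0 , # 0 , # 1)
  ∷ []

dot3 : Vec3 → Vec3 → ℕ
dot3 (a , b , c) (x , y , z) = (toℕ a * toℕ x + toℕ b * toℕ y + toℕ c * toℕ z) % 3

-- The line with (normalised) dual coordinates points[j]: the set of points
-- p with points[j] · p = 0 in F_3.  Every line of PG(2,3) arises exactly once.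
line : Fin 13 → Subset 13
line j = tabulate (λ i → isYes (dot3 (lookup points j) (lookup points i) ℕ.≟ 0))

lineSize : ∀ j → ∣ line j ∣ ≡ 4
lineSize = toWitness {a? = FinP.all? (λ j → ∣ line j ∣ ℕ.≟ 4)} tt

F4 : Hypergraph4
F4 = record
  { v = 13
  ; IsEdge = λ e → ∃ λ j → e ≡ line j
  ; edge4 = λ { e (j , refl) → lineSize j }
  }

-- N → (H₁ , H₂): every red/blue colouring of K_N^(4) contains a red copy of
-- H₁ or a blue copy of H₂.  r(H₁,H₂) is the least N with this property.
Arrows : ℕ → Hypergraph4 → Hypergraph4 → Set
Arrows N H₁ H₂ = (c : Colouring N) → MonoCopy c red H₁ ⊎ MonoCopy c blue H₂

-- Colour a 4-set of {0, …, N−1} red iff, at the lowest binary digit on which its elements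
-- do not all agree, they split 2–2.  If N ≤ 2^(n−2), a blue K_n would be n distinct numbers
-- below 2^(n−2) with no such split; but any m + 2 distinct numbers below 2^m contain one:
-- either both parity classes have two elements, or one class has m + 1 elements, whose
-- halves are m + 1 distinct numbers below 2^(m−1).  In a red F_4 every line contains an even
-- number of points with odd image; over 𝔽₂ the only such point sets of PG(2,3) are ∅ and
-- everything, so all images have the same lowest digit and halving them gives a red F_4 with
-- one digit less, until the images, which are distinct, would all be 0.
module Submission where

open import Defs
open import Data.Bool using (Bool; true; false; _∧_; _∨_)
open import Data.Bool.Properties using (∨-zeroʳ; ∧-conicalˡ; ∧-conicalʳ; T-≡)
open import Data.Empty using (⊥-elim)
open import Data.Fin using (Fin; #_; toℕ; fromℕ<) renaming (zero to fzero; suc to fsuc)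
import Data.Fin.Properties as FinP
open import Data.Fin.Properties
  using (all?; any?; toℕ<n; toℕ-injective; toℕ-fromℕ<; injective⇒≤)
open import Data.Fin.Subset using (Subset; ⁅_⁆; _∪_; ⊥; ∣_∣; inside; outside)
  renaming (_∈_ to _∈ˢ_; _∉_ to _∉ˢ_)
open import Data.Fin.Subset.Properties
  using (x∈p∪q⁺; x∈p∪q⁻; x∈⁅x⁆; x∈⁅y⁆⇒x≡y; ∉⊥; ∪-identityˡ; ∣⊥∣≡0) renaming (_∈?_ to _∈ˢ?_)
open import Data.List as List using (List; []; _∷_; length; map; filter)
open import Data.List.Membership.Propositional using (_∈_)
open import Data.List.Membership.Propositional.Properties using (∈-map⁻; ∈-filter⁻; ∈-tabulate⁻)
open import Data.List.Properties using (length-map; length-tabulate)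
open import Data.List.Relation.Unary.All as All using (All; []; _∷_)
import Data.List.Relation.Unary.All.Properties as All
open import Data.List.Relation.Unary.AllPairs using ([]; _∷_)
open import Data.List.Relation.Unary.Any using (here; there)
open import Data.List.Relation.Unary.Unique.Propositional using (Unique)
import Data.List.Relation.Unary.Unique.Propositional.Properties as Unique
open import Data.Nat
  using (ℕ; zero; suc; _+_; _*_; _^_; _≤_; _<_; z≤n; s≤s; z<s; s<s; parity; ⌊_/2⌋; _≟_; _≤?_)
open import Data.Nat.Properties
  using ( ≤-trans; <-trans; <-≤-trans; ≤-reflexive; ≤-pred; ≰⇒>; n<1+n; n<1⇒n≡0; m≤n+m
        ; suc-injective; +-suc; +-comm; +-monoˡ-≤; *-assoc; *-monoʳ-≤; *-cancelˡ-≤; ^-monoʳ-<)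
open import Data.Parity.Base as Parity using (Parity; 0ℙ; 1ℙ)
import Data.Parity.Properties as ℙ
import Data.Product as Product
open import Data.Product using (Σ-syntax; ∃-syntax; _×_; _,_; proj₁; proj₂)
open import Data.Sum using (inj₁; inj₂; [_,_])
open import Data.Vec as Vec using (Vec; []; _∷_; lookup; tabulate)
open import Data.Vec.Properties
  using (lookup⇒[]=; []=⇒lookup; lookup-map; lookup∘tabulate; map-cong)
open import Function using (_∘_; id)
open import Function.Bundles using (Equivalence)
open import Function.Definitions using (Injective)
open import Relation.Nullary using (¬_; Dec; yes; no)
open import Relation.Nullary.Decidable
  using (_×-dec_; _→-dec_; ¬?; map′; from-yes; from-no; toWitness; isYes; isYes≗does; dec-true)
open import Relation.Binary.PropositionalEquality
  using (_≡_; _≢_; refl; sym; trans; cong; cong₂; subst; subst₂)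

⌊n/2⌋-parity-injective : ∀ m n → parity m ≡ parity n → ⌊ m /2⌋ ≡ ⌊ n /2⌋ → m ≡ n
⌊n/2⌋-parity-injective 0             0             _ _ = refl
⌊n/2⌋-parity-injective 1             1             _ _ = refl
⌊n/2⌋-parity-injective 0             1             () _
⌊n/2⌋-parity-injective 1             0             () _
⌊n/2⌋-parity-injective (suc (suc m)) (suc (suc n)) p h =
  cong (λ k → suc (suc k)) (⌊n/2⌋-parity-injective m n p (suc-injective h))
⌊n/2⌋-parity-injective 0             (suc (suc n)) _ ()
⌊n/2⌋-parity-injective 1             (suc (suc n)) _ ()
⌊n/2⌋-parity-injective (suc (suc m)) 0             _ ()
⌊n/2⌋-parity-injective (suc (suc m)) 1             _ ()

n<2*m⇒⌊n/2⌋<m : ∀ n m → n < 2 * m → ⌊ n /2⌋ < m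
n<2*m⇒⌊n/2⌋<m 0             (suc m) _ = z<s
n<2*m⇒⌊n/2⌋<m 1             (suc m) _ = z<s
n<2*m⇒⌊n/2⌋<m (suc (suc n)) (suc m) (s<s n<) =
  s<s (n<2*m⇒⌊n/2⌋<m n m (≤-pred (subst (suc (suc n) ≤_) (+-suc m (m + 0)) n<)))

n<2^n : ∀ n → n < 2 ^ n
n<2^n zero    = z<s
n<2^n (suc n) = ≤-trans (s≤s (n<2^n n)) (^-monoʳ-< 2 (s≤s (s≤s z≤n)) (n<1+n n))

-- a, b, c, d agree in their t lowest binary digits, and digit t splits them into the two
-- pairs {a, b} and {c, d} of distinct numbers.
Balanced : ℕ → ℕ → ℕ → ℕ → ℕ → Set
Balanced zero    a b c d =
  a ≢ b × c ≢ d × parity a ≡ parity b × parity c ≡ parity d × parity a ≢ parity c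
Balanced (suc t) a b c d =
  parity a ≡ parity b × parity a ≡ parity c × parity a ≡ parity d ×
  Balanced t ⌊ a /2⌋ ⌊ b /2⌋ ⌊ c /2⌋ ⌊ d /2⌋

balanced? : ∀ t a b c d → Dec (Balanced t a b c d)
balanced? zero    a b c d =
  ¬? (a ≟ b) ×-dec ¬? (c ≟ d) ×-dec parity a ℙ.≟ parity b ×-dec parity c ℙ.≟ parity d
  ×-dec ¬? (parity a ℙ.≟ parity c)
balanced? (suc t) a b c d =
  parity a ℙ.≟ parity b ×-dec parity a ℙ.≟ parity c ×-dec parity a ℙ.≟ parity d
  ×-dec balanced? t ⌊ a /2⌋ ⌊ b /2⌋ ⌊ c /2⌋ ⌊ d /2⌋

Balanced⇒Unique : ∀ t {a b c d} → Balanced t a b c d → Unique (a ∷ b ∷ c ∷ d ∷ [])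
Balanced⇒Unique zero (a≢b , c≢d , ab , cd , a≁c) =
  (a≢b ∷ (λ a≡c → a≁c (cong parity a≡c)) ∷ (λ { refl → a≁c (sym cd) }) ∷ [])
  ∷ ((λ { refl → a≁c ab }) ∷ (λ { refl → a≁c (trans ab (sym cd)) }) ∷ [])
  ∷ (c≢d ∷ []) ∷ [] ∷ []
Balanced⇒Unique (suc t) (_ , _ , _ , bal) = Unique.map⁻ (Balanced⇒Unique t bal)

Balanced⇒pairs : ∀ t {a b c d} → Balanced t a b c d → parity a ≡ parity b × parity c ≡ parity d
Balanced⇒pairs zero    (_ , _ , ab , cd , _) = ab , cd
Balanced⇒pairs (suc t) (ab , ac , ad , _)    = ab , trans (sym ac) ad

BalancedQuadruple : ∀ {A : Set} → (A → ℕ) → Set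
BalancedQuadruple {A} x =
  Σ[ t ∈ ℕ ] Σ[ a ∈ A ] Σ[ b ∈ A ] Σ[ c ∈ A ] Σ[ d ∈ A ] Balanced t (x a) (x b) (x c) (x d)

⌊/2⌋-BalancedQuadruple : ∀ {A : Set} {x : A → ℕ} → (∀ a b → parity (x a) ≡ parity (x b)) →
  BalancedQuadruple x → BalancedQuadruple (⌊_/2⌋ ∘ x)
⌊/2⌋-BalancedQuadruple same (zero  , a , _ , c , _ , (_ , _ , _ , _ , a≁c)) =
  ⊥-elim (a≁c (same a c))
⌊/2⌋-BalancedQuadruple same (suc t , a , b , c , d , (_ , _ , _ , bal)) = t , a , b , c , d , bal

hasParity? : ∀ p x → Dec (parity x ≡ p)
hasParity? p x = parity x ℙ.≟ p

parityClass : Parity → List ℕ → List ℕ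
parityClass p = filter (hasParity? p)

length-parityClasses : ∀ xs → length (parityClass 0ℙ xs) + length (parityClass 1ℙ xs) ≡ length xs
length-parityClasses []       = refl
length-parityClasses (x ∷ xs) with parity x
... | 0ℙ = cong suc (length-parityClasses xs)
... | 1ℙ = trans (+-suc _ _) (cong suc (length-parityClasses xs))

BalancedBelow : ℕ → List ℕ → Set
BalancedBelow m xs = ∃[ t ] t < m × ∃[ a ] ∃[ b ] ∃[ c ] ∃[ d ]
  All (_∈ xs) (a ∷ b ∷ c ∷ d ∷ []) × Balanced t a b c d

two-in-parityClass : ∀ {p xs} → Unique xs → 2 ≤ length (parityClass p xs) →
  ∃[ x ] ∃[ y ] x ∈ xs × y ∈ xs × x ≢ y × parity x ≡ p × parity y ≡ p
two-in-parityClass {p} {xs} u 2≤ = first-two (Unique.filter⁺ _ u) 2≤ (∈-filter⁻ _)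
  where
  first-two : ∀ {ys} → Unique ys → 2 ≤ length ys → (∀ {z} → z ∈ ys → z ∈ xs × parity z ≡ p) →
    ∃[ x ] ∃[ y ] x ∈ xs × y ∈ xs × x ≢ y × parity x ≡ p × parity y ≡ p
  first-two {x ∷ y ∷ _} ((x≢y ∷ _) ∷ _) _ sub =
    let (x∈ , px) = sub (here refl) ; (y∈ , py) = sub (there (here refl)) in
    x , y , x∈ , y∈ , x≢y , px , py
  first-two {_ ∷ []} _ (s≤s ()) _

split-at-level-0 : ∀ {m xs} → Unique xs →
  2 ≤ length (parityClass 0ℙ xs) → 2 ≤ length (parityClass 1ℙ xs) → BalancedBelow (suc m) xs
split-at-level-0 u 2≤evens 2≤odds
  with two-in-parityClass u 2≤evens | two-in-parityClass u 2≤odds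
... | a , b , a∈ , b∈ , a≢b , pa , pb | c , d , c∈ , d∈ , c≢d , pc , pd =
  0 , z<s , a , b , c , d , (a∈ ∷ b∈ ∷ c∈ ∷ d∈ ∷ []) ,
  (a≢b , c≢d , trans pa (sym pb) , trans pc (sym pd) , λ ac → 0ℙ≢1ℙ (trans (sym pa) (trans ac pc)))
  where
  0ℙ≢1ℙ : 0ℙ ≢ 1ℙ
  0ℙ≢1ℙ ()

halved-parityClass⁻ : ∀ {p xs y} → y ∈ map ⌊_/2⌋ (parityClass p xs) →
  ∃[ x ] x ∈ xs × parity x ≡ p × y ≡ ⌊ x /2⌋
halved-parityClass⁻ y∈ with ∈-map⁻ ⌊_/2⌋ y∈
... | x , x∈ , refl = let (x∈xs , px) = ∈-filter⁻ _ x∈ in x , x∈xs , px , refl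

lift-halved : ∀ {m} p xs → BalancedBelow m (map ⌊_/2⌋ (parityClass p xs)) → BalancedBelow (suc m) xs
lift-halved p xs (t , t<m , _ , _ , _ , _ , ∈halves , bal) with All.map halved-parityClass⁻ ∈halves
... | (a , a∈xs , pa , refl) ∷ (b , b∈xs , pb , refl)
    ∷ (c , c∈xs , pc , refl) ∷ (d , d∈xs , pd , refl) ∷ [] =
  suc t , s<s t<m , a , b , c , d , (a∈xs ∷ b∈xs ∷ c∈xs ∷ d∈xs ∷ []) ,
  (trans pa (sym pb) , trans pa (sym pc) , trans pa (sym pd) , bal)

⌊/2⌋-Unique : ∀ {p xs} → All (λ x → parity x ≡ p) xs → Unique xs → Unique (map ⌊_/2⌋ xs)
⌊/2⌋-Unique []         []         = []
⌊/2⌋-Unique (px ∷ pxs) (x∉ ∷ u) =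
  All.map⁺ (All.zipWith (λ (x≢y , py) → x≢y ∘ ⌊n/2⌋-parity-injective _ _ (trans px (sym py)))
                        (x∉ , pxs))
  ∷ ⌊/2⌋-Unique pxs u

k<a+b∧a≱2⇒k≤b : ∀ {k a b} → suc k ≤ a + b → ¬ 2 ≤ a → k ≤ b
k<a+b∧a≱2⇒k≤b {b = b} k<a+b a≱2 = ≤-pred (≤-trans k<a+b (+-monoˡ-≤ b (≤-pred (≰⇒> a≱2))))

large-set-balanced : ∀ m {xs} → Unique xs → All (_< 2 ^ m) xs → 2 + m ≤ length xs →
  BalancedBelow m xs
large-set-balanced zero {x ∷ y ∷ _} ((x≢y ∷ _) ∷ _) (x<1 ∷ y<1 ∷ _) _ =
  ⊥-elim (x≢y (trans (n<1⇒n≡0 x<1) (sym (n<1⇒n≡0 y<1))))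
large-set-balanced zero {_ ∷ []} _ _ (s≤s ())
large-set-balanced (suc m) {xs} u bounded len =
  by-parity-split (2 ≤? length (parityClass 0ℙ xs)) (2 ≤? length (parityClass 1ℙ xs))
  where
  descend : ∀ p → 2 + m ≤ length (parityClass p xs) → BalancedBelow (suc m) xs
  descend p len′ = lift-halved p xs (large-set-balanced m
    (⌊/2⌋-Unique (All.all-filter (hasParity? p) xs) (Unique.filter⁺ (hasParity? p) u))
    (All.map⁺ (All.map (λ {x} → n<2*m⇒⌊n/2⌋<m x _) (All.filter⁺ (hasParity? p) bounded)))
    (subst (2 + m ≤_) (sym (length-map ⌊_/2⌋ (parityClass p xs))) len′))

  len′ : suc (2 + m) ≤ length (parityClass 0ℙ xs) + length (parityClass 1ℙ xs)
  len′ = subst (suc (2 + m) ≤_) (sym (length-parityClasses xs)) len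

  by-parity-split : Dec (2 ≤ length (parityClass 0ℙ xs)) → Dec (2 ≤ length (parityClass 1ℙ xs)) →
    BalancedBelow (suc m) xs
  by-parity-split (yes 2≤evens) (yes 2≤odds) = split-at-level-0 u 2≤evens 2≤odds
  by-parity-split (no evens<2)  _            = descend 1ℙ (k<a+b∧a≱2⇒k≤b len′ evens<2)
  by-parity-split (yes _)       (no odds<2)  =
    descend 0ℙ (k<a+b∧a≱2⇒k≤b (subst (suc (2 + m) ≤_) (+-comm (length (parityClass 0ℙ xs)) _) len′)
                               odds<2)

paritySum : ∀ {n} → Vec Parity n → Parity
paritySum = Vec.foldr′ Parity._+_ 0ℙ

∀-parityVec? : ∀ {n} {P : Vec Parity n → Set} → (∀ ps → Dec (P ps)) → Dec (∀ ps → P ps)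
∀-parityVec? {zero}  P? = map′ (λ { p [] → p }) (λ h → h []) (P? [])
∀-parityVec? {suc n} P? =
  map′ (λ { (p₀ , p₁) (0ℙ ∷ ps) → p₀ ps ; (p₀ , p₁) (1ℙ ∷ ps) → p₁ ps })
       (λ h → (λ ps → h (0ℙ ∷ ps)) , (λ ps → h (1ℙ ∷ ps)))
       (∀-parityVec? (λ ps → P? (0ℙ ∷ ps)) ×-dec ∀-parityVec? (λ ps → P? (1ℙ ∷ ps)))

-- Four distinct positions paired off into two pairs of equal entries cover all of Fin 4.
paired-paritySum≡0ℙ : ∀ (ps : Vec Parity 4) ka kb kc kd → Unique (ka ∷ kb ∷ kc ∷ kd ∷ []) →
  lookup ps ka ≡ lookup ps kb → lookup ps kc ≡ lookup ps kd → paritySum ps ≡ 0ℙ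
paired-paritySum≡0ℙ = from-yes (∀-parityVec? λ ps → all? λ ka → all? λ kb → all? λ kc → all? λ kd →
  unique? (ka ∷ kb ∷ kc ∷ kd ∷ []) →-dec lookup ps ka ℙ.≟ lookup ps kb →-dec
  lookup ps kc ℙ.≟ lookup ps kd →-dec paritySum ps ℙ.≟ 0ℙ)
  where open import Data.List.Relation.Unary.Unique.DecPropositional (FinP._≟_ {4}) using (unique?)

module ParityRigidity {v e : ℕ} (edge : Fin e → Vec (Fin v) 4) where

  EvenOnEdges : (Fin v → Parity) → Set
  EvenOnEdges c = ∀ j → paritySum (Vec.map c (edge j)) ≡ 0ℙ

  ParityRigid : Set
  ParityRigid = ∀ c → EvenOnEdges c → ∀ i k → c i ≡ c k

  BalancedEdges : (Fin v → ℕ) → Set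
  BalancedEdges φ = ∀ j → BalancedQuadruple (φ ∘ lookup (edge j))

  BalancedEdges⇒EvenOnEdges : ∀ {φ} → BalancedEdges φ → EvenOnEdges (parity ∘ φ)
  BalancedEdges⇒EvenOnEdges {φ} bal j with bal j
  ... | t , ka , kb , kc , kd , b with Balanced⇒pairs t b
  ...   | ab , cd =
    paired-paritySum≡0ℙ (Vec.map (parity ∘ φ) (edge j)) ka kb kc kd
      (Unique.map⁻ {f = φ ∘ lookup (edge j)} {xs = ka ∷ kb ∷ kc ∷ kd ∷ []} (Balanced⇒Unique t b))
      (trans (at ka) (trans ab (sym (at kb)))) (trans (at kc) (trans cd (sym (at kd))))
    where
    at : ∀ k → lookup (Vec.map (parity ∘ φ) (edge j)) k ≡ parity (φ (lookup (edge j) k))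
    at k = lookup-map k (parity ∘ φ) (edge j)

  ParityRigid⇒trivial : ParityRigid → ∀ M (φ : Fin v → ℕ) → Injective _≡_ _≡_ φ →
    (∀ i → φ i < 2 ^ M) → BalancedEdges φ → ∀ (i k : Fin v) → i ≡ k
  ParityRigid⇒trivial rigid zero    φ inj bounded _ i k =
    inj (trans (n<1⇒n≡0 (bounded i)) (sym (n<1⇒n≡0 (bounded k))))
  ParityRigid⇒trivial rigid (suc M) φ inj bounded bal =
    ParityRigid⇒trivial rigid M (⌊_/2⌋ ∘ φ)
      (λ {i} {k} → inj ∘ ⌊n/2⌋-parity-injective (φ i) (φ k) (same-parity i k))
      (λ i → n<2*m⇒⌊n/2⌋<m (φ i) _ (bounded i))
      (λ j → ⌊/2⌋-BalancedQuadruple {x = φ ∘ lookup (edge j)} (λ a b → same-parity _ _) (bal j))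
    where
    same-parity : ∀ i k → parity (φ i) ≡ parity (φ k)
    same-parity = rigid (parity ∘ φ) (BalancedEdges⇒EvenOnEdges {φ} bal)

linePoints : Fin 13 → Vec (Fin 13) 4
linePoints = lookup
  ( (# 9 ∷ # 10 ∷ # 11 ∷ # 12 ∷ []) ∷ (# 2 ∷ # 5 ∷ # 8 ∷ # 9 ∷ [])  ∷ (# 1 ∷ # 4 ∷ # 7 ∷ # 9 ∷ [])
  ∷ (# 6 ∷ # 7 ∷ # 8 ∷ # 12 ∷ [])  ∷ (# 2 ∷ # 4 ∷ # 6 ∷ # 11 ∷ []) ∷ (# 1 ∷ # 5 ∷ # 6 ∷ # 10 ∷ [])
  ∷ (# 3 ∷ # 4 ∷ # 5 ∷ # 12 ∷ [])  ∷ (# 2 ∷ # 3 ∷ # 7 ∷ # 10 ∷ []) ∷ (# 1 ∷ # 3 ∷ # 8 ∷ # 11 ∷ [])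
  ∷ (# 0 ∷ # 1 ∷ # 2 ∷ # 12 ∷ [])  ∷ (# 0 ∷ # 5 ∷ # 7 ∷ # 11 ∷ []) ∷ (# 0 ∷ # 4 ∷ # 8 ∷ # 10 ∷ [])
  ∷ (# 0 ∷ # 3 ∷ # 6 ∷ # 9 ∷ [])   ∷ [])

∈line⇒∈linePoints : ∀ j i → i ∈ˢ line j → ∃[ k ] lookup (linePoints j) k ≡ i
∈line⇒∈linePoints = from-yes (all? λ j → all? λ i →
  i ∈ˢ? line j →-dec any? λ k → lookup (linePoints j) k FinP.≟ i)

open ParityRigidity linePoints

-- Over 𝔽₂ the point–line incidence matrix of PG(2,3) has rank 12, its kernel being spanned
-- by the all-ones vector; the proof runs through all 2¹³ colourings.
PG[2,3]-parityRigid : ParityRigid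
PG[2,3]-parityRigid c even i k = trans (constant i) (sym (constant k))
  where
  on-vectors : ∀ (cs : Vec Parity 13) → EvenOnEdges (lookup cs) →
    ∀ i → lookup cs i ≡ lookup cs (# 0)
  on-vectors = from-yes (∀-parityVec? λ cs →
    all? (λ j → paritySum (Vec.map (lookup cs) (linePoints j)) ℙ.≟ 0ℙ) →-dec
    all? λ i → lookup cs i ℙ.≟ lookup cs (# 0))

  constant : ∀ i → c i ≡ c (# 0)
  constant i = subst₂ _≡_ (lookup∘tabulate c i) (lookup∘tabulate c (# 0))
    (on-vectors (tabulate c)
      (λ j → trans (cong paritySum (map-cong (lookup∘tabulate c) (linePoints j))) (even j)) i)

fromList : ∀ {n} → List (Fin n) → Subset n
fromList = List.foldr (λ i p → ⁅ i ⁆ ∪ p) ⊥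

∈-fromList⁺ : ∀ {n} {i : Fin n} {is} → i ∈ is → i ∈ˢ fromList is
∈-fromList⁺ {is = j ∷ _}  (here refl) = x∈p∪q⁺ (inj₁ (x∈⁅x⁆ j))
∈-fromList⁺ {is = j ∷ is} (there i∈)  = x∈p∪q⁺ {p = ⁅ j ⁆} (inj₂ (∈-fromList⁺ i∈))

∈-fromList⁻ : ∀ {n} {i : Fin n} is → i ∈ˢ fromList is → i ∈ is
∈-fromList⁻ []       i∈ = ⊥-elim (∉⊥ i∈)
∈-fromList⁻ (j ∷ is) i∈ with x∈p∪q⁻ ⁅ j ⁆ (fromList is) i∈
... | inj₁ i∈⁅j⁆ = here (x∈⁅y⁆⇒x≡y j i∈⁅j⁆)
... | inj₂ i∈is  = there (∈-fromList⁻ is i∈is)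

∣⁅x⁆∪p∣≡1+∣p∣ : ∀ {n} (x : Fin n) {p : Subset n} → x ∉ˢ p → ∣ ⁅ x ⁆ ∪ p ∣ ≡ suc ∣ p ∣
∣⁅x⁆∪p∣≡1+∣p∣ fzero   {outside ∷ p} _  = cong (suc ∘ ∣_∣) (∪-identityˡ p)
∣⁅x⁆∪p∣≡1+∣p∣ fzero   {inside ∷ p}  x∉ = ⊥-elim (x∉ Vec.here)
∣⁅x⁆∪p∣≡1+∣p∣ (fsuc x) {outside ∷ p} x∉ = ∣⁅x⁆∪p∣≡1+∣p∣ x (x∉ ∘ Vec.there)
∣⁅x⁆∪p∣≡1+∣p∣ (fsuc x) {inside ∷ p}  x∉ = cong suc (∣⁅x⁆∪p∣≡1+∣p∣ x (x∉ ∘ Vec.there))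

∣fromList∣≡length : ∀ {n} {is : List (Fin n)} → Unique is → ∣ fromList is ∣ ≡ length is
∣fromList∣≡length {n} {[]} [] = ∣⊥∣≡0 n
∣fromList∣≡length {n} {i ∷ is} (i∉ ∷ u) =
  trans (∣⁅x⁆∪p∣≡1+∣p∣ i (All.All¬⇒¬Any i∉ ∘ ∈-fromList⁻ is)) (cong suc (∣fromList∣≡length u))

anyFin⁺ : ∀ {n} (p : Fin n → Bool) i → p i ≡ true → anyFin p ≡ true
anyFin⁺ p fzero    pi = cong (_∨ anyFin (p ∘ fsuc)) pi
anyFin⁺ p (fsuc i) pi = trans (cong (p fzero ∨_) (anyFin⁺ (p ∘ fsuc) i pi)) (∨-zeroʳ (p fzero))

anyFin⁻ : ∀ {n} (p : Fin n → Bool) → anyFin p ≡ true → ∃[ i ] p i ≡ true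
anyFin⁻ {suc n} p h with p fzero in p0
... | true  = fzero , p0
... | false = Product.map fsuc id (anyFin⁻ (p ∘ fsuc) h)

∈-image⁺ : ∀ {v N} (f : Fin v → Fin N) {e i} → i ∈ˢ e → f i ∈ˢ image f e
∈-image⁺ f {e} {i} i∈e = lookup⇒[]= (f i) (image f e) (trans (lookup∘tabulate _ (f i))
  (anyFin⁺ _ i (cong₂ _∧_ ([]=⇒lookup i∈e) fi≟fi)))
  where
  fi≟fi : isYes (f i FinP.≟ f i) ≡ true
  fi≟fi = trans (isYes≗does (f i FinP.≟ f i)) (dec-true (f i FinP.≟ f i) refl)

∈-image⁻ : ∀ {v N} (f : Fin v → Fin N) {e x} → x ∈ˢ image f e → ∃[ i ] i ∈ˢ e × f i ≡ x
∈-image⁻ f {e} {x} x∈ with anyFin⁻ _ (trans (sym (lookup∘tabulate _ x)) ([]=⇒lookup x∈))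
... | i , h = i , lookup⇒[]= i e (∧-conicalˡ _ _ h) ,
  toWitness {a? = f i FinP.≟ x} (Equivalence.from T-≡ (∧-conicalʳ (lookup e i) _ h))

-- Levels are searched below N only to make Red decidable; the levels that occur for a blue
-- clique are below its size.
Red : ∀ {N} → Subset N → Set
Red {N} S = Σ[ t ∈ Fin N ] Σ[ a ∈ Fin N ] Σ[ b ∈ Fin N ] Σ[ c ∈ Fin N ] Σ[ d ∈ Fin N ]
  All (_∈ˢ S) (a ∷ b ∷ c ∷ d ∷ []) × Balanced (toℕ t) (toℕ a) (toℕ b) (toℕ c) (toℕ d)

red? : ∀ {N} (S : Subset N) → Dec (Red S)
red? S = any? λ t → any? λ a → any? λ b → any? λ c → any? λ d →
  All.all? (_∈ˢ? S) (a ∷ b ∷ c ∷ d ∷ []) ×-dec balanced? (toℕ t) (toℕ a) (toℕ b) (toℕ c) (toℕ d)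

colourOf : ∀ {A : Set} → Dec A → Colour
colourOf (yes _) = red
colourOf (no _)  = blue

colouring : ∀ {N} → Colouring N
colouring S = colourOf (red? S)

colouring≡red⇒Red : ∀ {N} (S : Subset N) → colouring S ≡ red → Red S
colouring≡red⇒Red S with red? S
... | yes r = λ _ → r
... | no _  = λ ()

Red⇒colouring≡red : ∀ {N} (S : Subset N) → Red S → colouring S ≡ red
Red⇒colouring≡red S r with red? S
... | yes _ = refl
... | no ¬r = ⊥-elim (¬r r)

∈-image⁻-covered : ∀ {v N} {A : Set} (f : Fin v → Fin N) {e} (g : A → Fin v) →
  (∀ {i} → i ∈ˢ e → ∃[ k ] g k ≡ i) → ∀ {x} → x ∈ˢ image f e → ∃[ k ] f (g k) ≡ x
∈-image⁻-covered f g covers x∈ with ∈-image⁻ f x∈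
... | i , i∈e , refl = Product.map id (cong f) (covers i∈e)

Red-image⁻ : ∀ {v N} {A : Set} (f : Fin v → Fin N) {e} (g : A → Fin v) →
  (∀ {i} → i ∈ˢ e → ∃[ k ] g k ≡ i) → Red (image f e) → BalancedQuadruple (toℕ ∘ f ∘ g)
Red-image⁻ f g covers (t , _ , _ , _ , _ , ∈image , bal)
  with All.map (∈-image⁻-covered f g covers) ∈image
... | (ka , refl) ∷ (kb , refl) ∷ (kc , refl) ∷ (kd , refl) ∷ [] = toℕ t , ka , kb , kc , kd , bal

Red-image⁺ : ∀ {v N} (f : Fin v → Fin N) {e t ia ib ic id} → t < N →
  All (_∈ˢ e) (ia ∷ ib ∷ ic ∷ id ∷ []) →
  Balanced t (toℕ (f ia)) (toℕ (f ib)) (toℕ (f ic)) (toℕ (f id)) → Red (image f e)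
Red-image⁺ f {ia = ia} {ib} {ic} {id} t<N ∈e bal =
  fromℕ< t<N , f ia , f ib , f ic , f id , All.map⁺ (All.map (∈-image⁺ f) ∈e) ,
  subst (λ s → Balanced s (toℕ (f ia)) (toℕ (f ib)) (toℕ (f ic)) (toℕ (f id)))
        (sym (toℕ-fromℕ< t<N)) bal

no-red-F4 : ∀ {N} → ¬ MonoCopy (colouring {N}) red F4
no-red-F4 {N} (f , inj , red-lines) = 0≢1 (ParityRigid⇒trivial PG[2,3]-parityRigid N (toℕ ∘ f)
  (inj ∘ toℕ-injective) (λ i → <-trans (toℕ<n (f i)) (n<2^n N))
  (λ j → Red-image⁻ f (lookup (linePoints j)) (∈line⇒∈linePoints j _)
    (colouring≡red⇒Red _ (red-lines (line j) (j , refl))))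
  (# 0) (# 1))
  where
  0≢1 : # 0 ≢ # 1
  0≢1 ()

no-blue-clique : ∀ m {N} → N ≤ 2 ^ m → ¬ MonoCopy (colouring {N}) blue (K4 (2 + m))
no-blue-clique m {N} N≤2^m (f , inj , blue-edges)
  with large-set-balanced m (Unique.tabulate⁺ (inj ∘ toℕ-injective))
         (All.tabulate⁺ (λ i → <-≤-trans (toℕ<n (f i)) N≤2^m))
         (≤-reflexive (sym (length-tabulate (toℕ ∘ f))))
... | t , t<m , _ , _ , _ , _ , ∈values , bal with All.map (∈-tabulate⁻ {f = toℕ ∘ f}) ∈values
... | (ia , refl) ∷ (ib , refl) ∷ (ic , refl) ∷ (id , refl) ∷ [] =
  red≢blue (trans (sym is-red) is-blue)
  where
  quadruple : List (Fin (2 + m))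
  quadruple = ia ∷ ib ∷ ic ∷ id ∷ []

  is-blue : colouring (image f (fromList quadruple)) ≡ blue
  is-blue = blue-edges (fromList quadruple)
    (∣fromList∣≡length (Unique.map⁻ {f = toℕ ∘ f} {xs = quadruple} (Balanced⇒Unique t bal)))

  is-red : colouring (image f (fromList quadruple)) ≡ red
  is-red = Red⇒colouring≡red _ (Red-image⁺ f {e = fromList quadruple}
    (<-≤-trans t<m (≤-trans (m≤n+m m 2) (injective⇒≤ inj))) (All.tabulate ∈-fromList⁺) bal)

  red≢blue : red ≢ blue
  red≢blue ()

proposition4p1 : (n : ℕ) → 1 ≤ n → (N : ℕ) → Arrows N F4 (K4 n) → 2 ^ n < 4 * N
proposition4p1 n 1≤n N arrows = ≰⇒> λ 4N≤2ⁿ → [ no-red-F4 , no-blue n 1≤n 4N≤2ⁿ ] (arrows colouring)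
  where
  no-blue : ∀ n → 1 ≤ n → 4 * N ≤ 2 ^ n → ¬ MonoCopy (colouring {N}) blue (K4 n)
  no-blue 0             ()
  no-blue 1             _ 4N≤2 (f , _) =
    from-no (4 ≤? 2) (≤-trans (*-monoʳ-≤ 4 (≤-trans (s≤s z≤n) (toℕ<n (f fzero)))) 4N≤2)
  no-blue (suc (suc m)) _ 4N≤2ⁿ        =
    no-blue-clique m (*-cancelˡ-≤ 4 (subst (4 * N ≤_) (sym (*-assoc 2 2 (2 ^ m))) 4N≤2ⁿ))
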